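{- Let $\mathcal N$ be a network of timed automata and let $a,b$ be actions with $\mathrm{dom}(a)\cap\mathrm{dom}(b)=\emptyset$. (1) If $(q,\nu)\Rightarrow^{ab}(q',\nu')$ then $(q,\nu)\Rightarrow^{ba}(q',\nu')$. (2) If $(q,\nu)\Rightarrow^{a}(q_a,\nu_a)$ and $(q,\nu)\Rightarrow^{b}(q_b,\nu_b)$, then $(q,\nu)\Rightarrow^{ab}(q_{ab},\nu_{ab})$ for some state $q_{ab}$ and local valuation $\nu_{ab}$.
   Context: Network: $\mathcal N=\langle A_1,\dots,A_k\rangle$, each $A_p=(Q_p,\Sigma_p,X_p,q^{init}_p,T_p)$ with finite state set $Q_p$, finite alphabet $\Sigma_p$, finite clock set $X_p$, initial state $q^{init}_p$, transitions $T_p\subseteq\Sigma_p\times Q_p\times\Phi(X_p)\times2^{X_p}\times Q_p$ with $\Phi(X_p)$ finite conjunctions of atoms $x\sim c$ ($c\in\mathbb N$, $\sim\in\{<,\le,=,\ge,>\}$). $Q_p$ pairwise disjoint, $X_p$ pairwise disjoint; $Q=\prod_pQ_p$, $q(p)$ the $p$-th component, $\Sigma=\bigcup\Sigma_p$, $X=\bigcup X_p$, $\mathrm{dom}(b)=\{p:b\in\Sigma_p\}$. Local-time semantics: offset variables $\tilde x$ for $x\in X$, $\tilde X_p=\{\tilde x:x\in X_p\}$, $\tilde X=\bigcup\tilde X_p$, and a reference clock $t_p$ per process. A local valuation is $\nu:\tilde X\cup\{t_1,\dots,t_k\}\to\mathbb R_{\ge0}$ with $\nu(t_p)\ge\nu(\tilde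 x)$ for all $p$ and $\tilde x\in\tilde X_p$. The value of $x\in X_p$ is $\nu(t_p)-\nu(\tilde x)$; $\nu\models g$ means each atom of $g$ holds for these values. $\nu+_p\delta$ adds $\delta\ge0$ to $\nu(t_p)$ only. $[R]\nu$ keeps all $t_p$, sets $\tilde x:=\nu(t_p)$ for $x\in R\cap X_p$, and keeps other offsets. Local steps: local delay $(q,\nu)\Rightarrow_{p,\delta}(q,\nu+_p\delta)$; local action $(q,\nu)\Rightarrow_b(q',\nu')$ if there are $b$-transitions $(b,q_p,g_p,R_p,q'_p)\in T_p$, $p\in\mathrm{dom}(b)$, with $q_p=q(p)$, $q'_p=q'(p)$ for $p\in\mathrm{dom}(b)$, $q'(p)=q(p)$ otherwise, $\nu(t_{p_1})=\nu(t_{p_2})$ for all $p_1,p_2\in\mathrm{dom}(b)$, $\nu\models g_p$ for all $p\in\mathrm{dom}(b)$, and $\nu'=[\bigcup_pR_p]\nu$. A sequence of local delays $\Delta=(p_1,\delta_1)\cdots(p_m,\delta_m)$ is applied successively, written $\Rightarrow_\Delta$. For $u=b_1\cdots b_n$, $(q_0,\nu_0)\Rightarrow^u(q_n,\nu_n')$ means there are sequences of local delays $\Delta_0,\dots,\Delta_n$ with $(q_0,\nu_0)\Rightarrow_{\Delta_0}(q_0,\nu_0')\Rightarrow_{b_1}(q_1,\nu_1)\Rightarrow_{\Delta_1}\cdots\Rightarrow_{b_n}(q_n,\nu_n)\Rightarrow_{\Delta_n}(q_n,\nu_n')$. -}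

module Defs where

open import Level using (0ℓ)
open import Data.Nat using (ℕ; zero; suc)
open import Data.Fin using (Fin)
open import Data.Fin.Subset using (Subset; _∈_; _∉_)
open import Data.List using (List; []; _∷_; length)
open import Data.List.Relation.Unary.All using (All)
open import Data.List.Membership.Propositional using () renaming (_∈_ to _∈ₗ_)
open import Data.Sum using (_⊎_)
open import Data.Product using (Σ; ∃; ∃-syntax; _×_; _,_)
open import Relation.Binary.PropositionalEquality using (_≡_; _≢_)
open import Relation.Nullary using (¬_)

-- The real line, axiomatised as a complete ordered field (the stdlib has
-- no reals).  Every model is isomorphic to ℝ, so quantifying over all
-- models is the same as speaking about ℝ.

record Reals : Set₁ where
  infixl 6 _+_
  infixl 7 _*_
  infix 4 _≤_
  field
    ℝ    : Set
    0# 1# : ℝ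
    _+_ _*_ : ℝ → ℝ → ℝ
    -_   : ℝ → ℝ
    _≤_  : ℝ → ℝ → Set
    +-assoc     : ∀ x y z → (x + y) + z ≡ x + (y + z)
    +-comm      : ∀ x y → x + y ≡ y + x
    +-identityˡ : ∀ x → 0# + x ≡ x
    -‿inverseˡ  : ∀ x → (- x) + x ≡ 0#
    *-assoc     : ∀ x y z → (x * y) * z ≡ x * (y * z)
    *-comm      : ∀ x y → x * y ≡ y * x
    *-identityˡ : ∀ x → 1# * x ≡ x
    distribʳ    : ∀ x y z → (y + z) * x ≡ y * x + z * x
    0≢1         : 0# ≢ 1#
    inverse     : ∀ x → x ≢ 0# → ∃[ y ] (y * x ≡ 1#)
    ≤-refl      : ∀ x → x ≤ x
    ≤-trans     : ∀ {x y z} → x ≤ y → y ≤ z → x ≤ z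
    ≤-antisym   : ∀ {x y} → x ≤ y → y ≤ x → x ≡ y
    ≤-total     : ∀ x y → (x ≤ y) ⊎ (y ≤ x)
    +-mono-≤    : ∀ {x y} z → x ≤ y → x + z ≤ y + z
    *-nonneg    : ∀ {x y} → 0# ≤ x → 0# ≤ y → 0# ≤ x * y
    complete    : (S : ℝ → Set) → ∃ S → (∃[ u ] (∀ x → S x → x ≤ u)) →
                  ∃[ s ] ((∀ x → S x → x ≤ s) × (∀ u → (∀ x → S x → x ≤ u) → s ≤ u))

  _-_ : ℝ → ℝ → ℝ
  x - y = x + (- y)

  _<_ : ℝ → ℝ → Set
  x < y = (x ≤ y) × (x ≢ y)

  fromℕ : ℕ → ℝ
  fromℕ zero    = 0#
  fromℕ (suc n) = 1# + fromℕ n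

  ℝ≥0 : Set
  ℝ≥0 = Σ ℝ (λ x → 0# ≤ x)

data Cmp : Set where
  lt le eq ge gt : Cmp

record Atom (n : ℕ) : Set where
  constructor atom
  field
    clock : Fin n
    cmp   : Cmp
    const : ℕ

-- a transition (b, q, g, R, q') with b ∈ Fin nΣ, states Fin nQ, clocks Fin nX;
-- the guard is a finite conjunction of atoms, the reset a subset of clocks
record Trans (nΣ nQ nX : ℕ) : Set where
  field
    label : Fin nΣ
    src   : Fin nQ
    guard : List (Atom nX)
    reset : Subset nX
    tgt   : Fin nQ

-- a network of k timed automata; process p has states Fin (nQ p) and
-- clocks Fin (nX p) (disjointness is built in by indexing with p);
-- the global alphabet Σ is Fin nΣ and Σ_p ⊆ Σ is  alph p.
record Network : Set where
  field
    k     : ℕ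
    nQ    : Fin k → ℕ
    nX    : Fin k → ℕ
    nΣ    : ℕ
    alph  : (p : Fin k) → Subset nΣ
    cover : ∀ (b : Fin nΣ) → ∃[ p ] (b ∈ alph p)


    init   : (p : Fin k) → Fin (nQ p)
    trans  : (p : Fin k) → List (Trans nΣ (nQ p) (nX p))
    trans-wf : (p : Fin k) → All (λ t → Trans.label t ∈ alph p) (trans p)

  _∈dom_ : Fin k → Fin nΣ → Set
  p ∈dom b = b ∈ alph p

  State : Set
  State = (p : Fin k) → Fin (nQ p)

module LocalTime (R : Reals) (N : Network) where
  open Reals R
  open Network N

  -- local valuation: offsets x̃ for x ∈ X_p and reference clocks t_p,
  -- all in ℝ≥0, with ν(t_p) ≥ ν(x̃) for x̃ ∈ X̃_p
  record LocalVal : Set where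
    field
      off    : (p : Fin k) → Fin (nX p) → ℝ
      ref    : Fin k → ℝ
      off≥0  : ∀ p x → 0# ≤ off p x
      ref≥0  : ∀ p → 0# ≤ ref p
      off≤ref : ∀ p x → off p x ≤ ref p
  open LocalVal public

  clockVal : LocalVal → (p : Fin k) → Fin (nX p) → ℝ
  clockVal ν p x = ref ν p - off ν p x

  sat-cmp : Cmp → ℝ → ℝ → Set
  sat-cmp lt v c = v < c
  sat-cmp le v c = v ≤ c
  sat-cmp eq v c = v ≡ c
  sat-cmp ge v c = c ≤ v
  sat-cmp gt v c = c < v

  Sat : LocalVal → (p : Fin k) → List (Atom (nX p)) → Set
  Sat ν p g = All (λ a → sat-cmp (Atom.cmp a) (clockVal ν p (Atom.clock a)) (fromℕ (Atom.const a))) g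

  record Conf : Set where
    constructor ⟨_,_⟩
    field
      st  : State
      val : LocalVal
  open Conf public

  -- equality of configurations (componentwise / pointwise; values are functions)
  _≈_ : Conf → Conf → Set
  c ≈ c' = (∀ p → st c p ≡ st c' p)
         × (∀ p → ref (val c) p ≡ ref (val c') p)
         × (∀ p x → off (val c) p x ≡ off (val c') p x)

  DelayStep : Fin k → ℝ≥0 → Conf → Conf → Set
  DelayStep p (δ , _) c c' =
      (∀ r → st c' r ≡ st c r)
    × (ref (val c') p ≡ ref (val c) p + δ)
    × (∀ r → r ≢ p → ref (val c') r ≡ ref (val c) r)
    × (∀ r x → off (val c') r x ≡ off (val c) r x)

  data Delays : Conf → Conf → Set where
    done : ∀ {c c'} → c ≈ c' → Delays c c'
    step : ∀ {c c₁ c'} (p : Fin k) (δ : ℝ≥0) →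
           DelayStep p δ c c₁ → Delays c₁ c' → Delays c c'

  ActionStep : Fin nΣ → Conf → Conf → Set
  ActionStep b c c' =
    Σ ((p : Fin k) → p ∈dom b → Trans nΣ (nQ p) (nX p)) λ τ → (
        (∀ p (h : p ∈dom b) → τ p h ∈ₗ trans p)
      × (∀ p (h : p ∈dom b) → Trans.label (τ p h) ≡ b)
      × (∀ p (h : p ∈dom b) → Trans.src (τ p h) ≡ st c p)
      × (∀ p (h : p ∈dom b) → Trans.tgt (τ p h) ≡ st c' p)
      × (∀ p → ¬ (p ∈dom b) → st c' p ≡ st c p)
      × (∀ p₁ p₂ → p₁ ∈dom b → p₂ ∈dom b → ref (val c) p₁ ≡ ref (val c) p₂)
      × (∀ p (h : p ∈dom b) → Sat (val c) p (Trans.guard (τ p h)))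
      × (∀ p → ref (val c') p ≡ ref (val c) p)
      × (∀ p x (h : p ∈dom b) → x ∈ Trans.reset (τ p h) → off (val c') p x ≡ ref (val c) p)
      × (∀ p x → ¬ (Σ (p ∈dom b) (λ h → x ∈ Trans.reset (τ p h))) →
                 off (val c') p x ≡ off (val c) p x))

  Run : Conf → List (Fin nΣ) → Conf → Set
  Run c []      c' = Delays c c'
  Run c (b ∷ u) c' = ∃[ c₁ ] ∃[ c₂ ] (Delays c c₁ × ActionStep b c₁ c₂ × Run c₂ u c')

-- An action reads and writes only the components (state, reference clock,
-- offsets) of the processes in its domain, while local delays move each
-- reference clock forward independently.  So an action can be replayed from any
-- configuration that can be delayed to agree with its source on its domain, and
-- the replay leaves all other processes untouched.  With disjoint domains we can
-- therefore fire b first from the initial configuration, then a, and catch up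
-- with the original target by delays; replaying both actions from the common
-- start gives the diamond.
module Submission where

open import Level using (0ℓ)
open import Data.Bool using (if_then_else_)
open import Data.Fin using (Fin)
open import Data.Fin.Properties using (_≟_)
open import Data.Fin.Subset using (_∈_)
open import Data.Fin.Subset.Properties using (_∈?_)
open import Data.List using (List; []; _∷_; allFin)
open import Data.List.Membership.Propositional using () renaming (_∉_ to _∉ₗ_)
open import Data.List.Membership.Propositional.Properties using (∈-allFin)
open import Data.List.Relation.Unary.Any using (here; there)
import Data.List.Relation.Unary.All as All
open import Data.Product using (Σ; _×_; _,_; ∃-syntax)
open import Relation.Binary.Bundles using (Preorder)
open import Relation.Binary.PropositionalEquality
  using (_≡_; refl; sym; trans; cong; cong₂; subst; subst₂; module ≡-Reasoning)
import Relation.Binary.Reasoning.Preorder as PreorderReasoning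
open import Relation.Nullary using (¬_; does; yes; no; contradiction)
open import Relation.Nullary.Decidable using (dec-true; dec-false)
open import Relation.Unary using (Pred; Decidable)

open import Defs

module OrderedFieldProperties (R : Reals) where
  open Reals R

  ≡⇒≤ : ∀ {x y} → x ≡ y → x ≤ y
  ≡⇒≤ {x} refl = ≤-refl x

  x≤x+δ : ∀ x {δ} → 0# ≤ δ → x ≤ x + δ
  x≤x+δ x {δ} 0≤δ = subst₂ _≤_ (+-identityˡ x) (+-comm δ x) (+-mono-≤ x 0≤δ)

  x+[y-x]≡y : ∀ x y → x + (y - x) ≡ y
  x+[y-x]≡y x y = begin
    x + (y + - x)   ≡⟨ cong (x +_) (+-comm y (- x)) ⟩
    x + (- x + y)   ≡⟨ sym (+-assoc x (- x) y) ⟩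
    (x + - x) + y   ≡⟨ cong (_+ y) (trans (+-comm x (- x)) (-‿inverseˡ x)) ⟩
    0# + y          ≡⟨ +-identityˡ y ⟩
    y               ∎
    where open ≡-Reasoning

  x≤y⇒0≤y-x : ∀ {x y} → x ≤ y → 0# ≤ y - x
  x≤y⇒0≤y-x {x} {y} x≤y =
    subst (_≤ y - x) (trans (+-comm x (- x)) (-‿inverseˡ x)) (+-mono-≤ (- x) x≤y)

module IndependentActions (R : Reals) (N : Network) where
  open Reals R
  open Network N hiding (trans)
  open LocalTime R N
  open OrderedFieldProperties R

  record _≈[_]_ (c : Conf) (p : Fin k) (d : Conf) : Set where
    field
      st≡  : st c p ≡ st d p
      ref≡ : ref (val c) p ≡ ref (val d) p
      off≡ : ∀ x → off (val c) p x ≡ off (val d) p x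

  record _≼[_]_ (c : Conf) (p : Fin k) (d : Conf) : Set where
    field
      st≡  : st c p ≡ st d p
      ref≤ : ref (val c) p ≤ ref (val d) p
      off≡ : ∀ x → off (val c) p x ≡ off (val d) p x

  open _≈[_]_
  open _≼[_]_

  _≼_ : Conf → Conf → Set
  c ≼ d = ∀ p → c ≼[ p ] d

  module _ {p : Fin k} where

    ≈-refl : ∀ {c} → c ≈[ p ] c
    ≈-refl = record { st≡ = refl ; ref≡ = refl ; off≡ = λ _ → refl }

    ≈-sym : ∀ {c d} → c ≈[ p ] d → d ≈[ p ] c
    ≈-sym e = record { st≡ = sym (st≡ e) ; ref≡ = sym (ref≡ e) ; off≡ = λ x → sym (off≡ e x) }

    ≈-trans : ∀ {c d e} → c ≈[ p ] d → d ≈[ p ] e → c ≈[ p ] e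
    ≈-trans e e' = record
      { st≡ = trans (st≡ e) (st≡ e') ; ref≡ = trans (ref≡ e) (ref≡ e')
      ; off≡ = λ x → trans (off≡ e x) (off≡ e' x) }

    ≈⇒≼ : ∀ {c d} → c ≈[ p ] d → c ≼[ p ] d
    ≈⇒≼ e = record { st≡ = st≡ e ; ref≤ = ≡⇒≤ (ref≡ e) ; off≡ = off≡ e }

    ≼-trans : ∀ {c d e} → c ≼[ p ] d → d ≼[ p ] e → c ≼[ p ] e
    ≼-trans h h' = record
      { st≡ = trans (st≡ h) (st≡ h') ; ref≤ = ≤-trans (ref≤ h) (ref≤ h')
      ; off≡ = λ x → trans (off≡ h x) (off≡ h' x) }

  ≼[_]-preorder : Fin k → Preorder 0ℓ 0ℓ 0ℓ
  ≼[ p ]-preorder = record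
    { Carrier = Conf
    ; _≈_ = _≈[ p ]_
    ; _≲_ = _≼[ p ]_
    ; isPreorder = record
      { isEquivalence = record { refl = ≈-refl ; sym = ≈-sym ; trans = ≈-trans }
      ; reflexive = ≈⇒≼
      ; trans = ≼-trans
      }
    }

  module ≼-Reasoning (p : Fin k) = PreorderReasoning ≼[ p ]-preorder

  sat-≈ : ∀ {c d p g} → c ≈[ p ] d → Sat (val c) p g → Sat (val d) p g
  sat-≈ e = All.map λ {a} → subst (λ v → sat-cmp (Atom.cmp a) v (fromℕ (Atom.const a)))
                                   (cong₂ _-_ (ref≡ e) (off≡ e (Atom.clock a)))

  delayStep⇒≼ : ∀ {p δ c d} → DelayStep p δ c d → c ≼ d
  delayStep⇒≼ {p} {δ , 0≤δ} {c} {d} (st= , ref-p , ref-r , off=) r = record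
    { st≡ = sym (st= r) ; ref≤ = ref≤-at r ; off≡ = λ x → sym (off= r x) }
    where
    ref≤-at : ∀ r → ref (val c) r ≤ ref (val d) r
    ref≤-at r with r ≟ p
    ... | yes refl = subst (ref (val c) p ≤_) (sym ref-p) (x≤x+δ _ 0≤δ)
    ... | no r≢p   = ≡⇒≤ (sym (ref-r r r≢p))

  delays⇒≼ : ∀ {c d} → Delays c d → c ≼ d
  delays⇒≼ (done (st= , ref= , off=)) p =
    record { st≡ = st= p ; ref≤ = ≡⇒≤ (ref= p) ; off≡ = off= p }
  delays⇒≼ (step _ δ s ds) p = ≼-trans (delayStep⇒≼ {δ = δ} s p) (delays⇒≼ ds p)

  module _ {S : Pred (Fin k) 0ℓ} (S? : Decidable S) where

    opaque
      override : Conf → Conf → Conf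
      override c d = ⟨ (λ p → st (from p) p) , record
        { off = λ p → off (val (from p)) p ; ref = λ p → ref (val (from p)) p
        ; off≥0 = λ p → off≥0 (val (from p)) p ; ref≥0 = λ p → ref≥0 (val (from p)) p
        ; off≤ref = λ p → off≤ref (val (from p)) p } ⟩
        where
        from : Fin k → Conf
        from p = if does (S? p) then c else d

    opaque
      unfolding override

      override-at : ∀ {c d p t} → does (S? p) ≡ t → override c d ≈[ p ] (if t then c else d)
      override-at refl = record { st≡ = refl ; ref≡ = refl ; off≡ = λ _ → refl }

    override-∈ : ∀ {c d p} → S p → override c d ≈[ p ] c
    override-∈ {p = p} s = override-at (dec-true (S? p) s)

    override-∉ : ∀ {c d p} → ¬ S p → override c d ≈[ p ] d
    override-∉ {p = p} ¬s = override-at (dec-false (S? p) ¬s)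

    ≼-override : ∀ {c d} → (∀ p → S p → c ≼[ p ] d) → c ≼ override d c
    ≼-override c≼d p with S? p
    ... | yes s = ≼-trans (c≼d p s) (≈⇒≼ (≈-sym (override-∈ s)))
    ... | no ¬s = ≈⇒≼ (≈-sym (override-∉ ¬s))

  raise : Fin k → Conf → Conf → Conf
  raise p c d = override (_≟ p) d c

  gap : ∀ {c d p} → c ≼[ p ] d → ℝ≥0
  gap {c} {d} {p} c≼d = ref (val d) p - ref (val c) p , x≤y⇒0≤y-x (ref≤ c≼d)

  delayStep-raise : ∀ {c d p} (c≼d : c ≼ d) → DelayStep p (gap (c≼d p)) c (raise p c d)
  delayStep-raise {c} {d} {p} c≼d =
      (λ r → sym (st≡ (c≼raise r)))
    , trans (ref≡ (override-∈ (_≟ p) refl)) (sym (x+[y-x]≡y _ _))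
    , (λ r r≢p → ref≡ (override-∉ (_≟ p) r≢p))
    , (λ r x → sym (off≡ (c≼raise r) x))
    where
    c≼raise : c ≼ raise p c d
    c≼raise = ≼-override (_≟ p) λ { _ refl → c≼d p }

  ≼⇒delays-outside : ∀ (L : List (Fin k)) {c d} → c ≼ d →
    (∀ p → p ∉ₗ L → ref (val c) p ≡ ref (val d) p) → Delays c d
  ≼⇒delays-outside [] c≼d fixed =
    done ((λ p → st≡ (c≼d p)) , (λ p → fixed p λ ()) , (λ p → off≡ (c≼d p)))
  ≼⇒delays-outside (p ∷ L) {c} {d} c≼d fixed =
    step p (gap (c≼d p)) (delayStep-raise c≼d) (≼⇒delays-outside L raise≼d fixed')
    where
    raise≼d : raise p c d ≼ d
    raise≼d r with r ≟ p
    ... | yes r≡p = ≈⇒≼ (override-∈ (_≟ p) r≡p)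
    ... | no r≢p  = ≼-trans (≈⇒≼ (override-∉ (_≟ p) r≢p)) (c≼d r)
    fixed' : ∀ r → r ∉ₗ L → ref (val (raise p c d)) r ≡ ref (val d) r
    fixed' r r∉L with r ≟ p
    ... | yes r≡p = ref≡ (override-∈ (_≟ p) r≡p)
    ... | no r≢p  = trans (ref≡ (override-∉ (_≟ p) r≢p))
                          (fixed r λ { (here r≡p) → r≢p r≡p ; (there r∈L) → r∉L r∈L })

  ≼⇒delays : ∀ {c d} → c ≼ d → Delays c d
  ≼⇒delays c≼d = ≼⇒delays-outside (allFin k) c≼d λ p p∉ → contradiction (∈-allFin p) p∉

  dom? : (b : Fin nΣ) → Decidable (_∈dom b)
  dom? b p = b ∈? alph p

  action-frame : ∀ {b X Y p} → ActionStep b X Y → ¬ p ∈dom b → X ≈[ p ] Y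
  action-frame (_ , _ , _ , _ , _ , frame , _ , _ , ref= , _ , unreset) ¬h = record
    { st≡ = sym (frame _ ¬h) ; ref≡ = sym (ref= _)
    ; off≡ = λ x → sym (unreset _ x λ (h , _) → ¬h h) }

  action-local : ∀ {b X Y Z W} → ActionStep b X Y →
    (∀ p → p ∈dom b → Z ≈[ p ] X) → (∀ p → p ∈dom b → W ≈[ p ] Y) →
    (∀ p → ¬ p ∈dom b → W ≈[ p ] Z) → ActionStep b Z W
  action-local {b} {X} {Y} {Z} {W}
    (τ , mem , lab , src , tgt , _ , sync , sat , ref= , reset , unreset) Z≈X W≈Y W≈Z =
      τ , mem , lab
    , (λ p h → trans (src p h) (sym (st≡ (Z≈X p h))))
    , (λ p h → trans (tgt p h) (sym (st≡ (W≈Y p h))))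
    , (λ p ¬h → st≡ (W≈Z p ¬h))
    , (λ p₁ p₂ h₁ h₂ → trans (ref≡ (Z≈X p₁ h₁)) (trans (sync p₁ p₂ h₁ h₂) (sym (ref≡ (Z≈X p₂ h₂)))))
    , (λ p h → sat-≈ (≈-sym (Z≈X p h)) (sat p h))
    , ref-kept
    , (λ p x h x∈R → trans (off≡ (W≈Y p h) x) (trans (reset p x h x∈R) (sym (ref≡ (Z≈X p h)))))
    , off-kept
    where
    ref-kept : ∀ p → ref (val W) p ≡ ref (val Z) p
    ref-kept p with dom? b p
    ... | yes h = trans (ref≡ (W≈Y p h)) (trans (ref= p) (sym (ref≡ (Z≈X p h))))
    ... | no ¬h = ref≡ (W≈Z p ¬h)
    off-kept : ∀ p x → ¬ Σ (p ∈dom b) (λ h → x ∈ Trans.reset (τ p h)) →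
               off (val W) p x ≡ off (val Z) p x
    off-kept p x unreset-x with dom? b p
    ... | yes h = trans (off≡ (W≈Y p h) x) (trans (unreset p x unreset-x) (sym (off≡ (Z≈X p h) x)))
    ... | no ¬h = off≡ (W≈Z p ¬h) x

  replay : ∀ {b X Y c c' u} → ActionStep b X Y → (∀ p → p ∈dom b → c ≼[ p ] X) →
    Run (override (dom? b) Y c) u c' → Run c (b ∷ u) c'
  replay {b} {c = c} act c≼X run =
      override (dom? b) _ c , _
    , ≼⇒delays (≼-override (dom? b) c≼X)
    , action-local act (λ _ → override-∈ (dom? b)) (λ _ → override-∈ (dom? b))
                       (λ _ ¬h → ≈-trans (override-∉ (dom? b) ¬h) (≈-sym (override-∉ (dom? b) ¬h)))
    , run

  module _ {a b : Fin nΣ} (disjoint : ∀ p → ¬ (p ∈dom a × p ∈dom b)) where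

    a⇒¬b : ∀ {p} → p ∈dom a → ¬ p ∈dom b
    a⇒¬b h h' = disjoint _ (h , h')

    b⇒¬a : ∀ {p} → p ∈dom b → ¬ p ∈dom a
    b⇒¬a h h' = disjoint _ (h' , h)

    commute : ∀ c c' → Run c (a ∷ b ∷ []) c' → Run c (b ∷ a ∷ []) c'
    commute c c' (C₁ , C₂ , c→C₁ , act-a , C₃ , C₄ , C₂→C₃ , act-b , C₄→c') =
      replay act-b c≼C₃ (replay act-a E≼C₁ (≼⇒delays F≼c'))
      where
      E F : Conf
      E = override (dom? b) C₄ c
      F = override (dom? a) C₂ E

      c≼C₁ : c ≼ C₁
      c≼C₁ = delays⇒≼ c→C₁

      C₂≼C₃ : C₂ ≼ C₃
      C₂≼C₃ = delays⇒≼ C₂→C₃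

      C₄≼c' : C₄ ≼ c'
      C₄≼c' = delays⇒≼ C₄→c'

      c≼C₃ : ∀ p → p ∈dom b → c ≼[ p ] C₃
      c≼C₃ p h = begin
        c  ≲⟨ c≼C₁ p ⟩
        C₁ ≈⟨ action-frame act-a (b⇒¬a h) ⟩
        C₂ ≲⟨ C₂≼C₃ p ⟩
        C₃ ∎
        where open ≼-Reasoning p

      E≼C₁ : ∀ p → p ∈dom a → E ≼[ p ] C₁
      E≼C₁ p h = ≼-trans (≈⇒≼ (override-∉ (dom? b) (a⇒¬b h))) (c≼C₁ p)

      F≼c' : F ≼ c'
      F≼c' p with dom? a p | dom? b p
      ... | yes h | _ = begin
        F  ≈⟨ override-∈ (dom? a) h ⟩
        C₂ ≲⟨ C₂≼C₃ p ⟩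
        C₃ ≈⟨ action-frame act-b (a⇒¬b h) ⟩
        C₄ ≲⟨ C₄≼c' p ⟩
        c' ∎
        where open ≼-Reasoning p
      ... | no ¬h | yes h' = begin
        F  ≈⟨ override-∉ (dom? a) ¬h ⟩
        E  ≈⟨ override-∈ (dom? b) h' ⟩
        C₄ ≲⟨ C₄≼c' p ⟩
        c' ∎
        where open ≼-Reasoning p
      ... | no ¬h | no ¬h' = begin
        F  ≈⟨ override-∉ (dom? a) ¬h ⟩
        E  ≈⟨ override-∉ (dom? b) ¬h' ⟩
        c  ≲⟨ c≼C₁ p ⟩
        C₁ ≈⟨ action-frame act-a ¬h ⟩
        C₂ ≲⟨ C₂≼C₃ p ⟩
        C₃ ≈⟨ action-frame act-b ¬h' ⟩
        C₄ ≲⟨ C₄≼c' p ⟩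
        c' ∎
        where open ≼-Reasoning p

    diamond : ∀ c ca cb → Run c (a ∷ []) ca → Run c (b ∷ []) cb → ∃[ cab ] Run c (a ∷ b ∷ []) cab
    diamond c _ _ (A₁ , A₂ , c→A₁ , act-a , _) (B₁ , B₂ , c→B₁ , act-b , _) =
      F , replay act-a (λ p _ → delays⇒≼ c→A₁ p)
            (replay act-b E≼B₁ (done ((λ _ → refl) , (λ _ → refl) , (λ _ _ → refl))))
      where
      E F : Conf
      E = override (dom? a) A₂ c
      F = override (dom? b) B₂ E

      E≼B₁ : ∀ p → p ∈dom b → E ≼[ p ] B₁
      E≼B₁ p h = ≼-trans (≈⇒≼ (override-∉ (dom? a) (b⇒¬a h))) (delays⇒≼ c→B₁ p)

lemma7 : (R : Reals) (N : Network) →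
    let open Network N in
    let open LocalTime R N in
    (a b : Fin nΣ) → (∀ p → ¬ (p ∈dom a × p ∈dom b)) →
    (∀ (c c' : Conf) → Run c (a ∷ b ∷ []) c' → Run c (b ∷ a ∷ []) c')
    × (∀ (c ca cb : Conf) → Run c (a ∷ []) ca → Run c (b ∷ []) cb →
    ∃[ cab ] Run c (a ∷ b ∷ []) cab)
lemma7 R N a b disjoint = commute disjoint , diamond disjoint
  where open IndependentActions R N
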